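{- Over $\mathbf{BIM}$, the schema $\mathrm{CF_d}$ entails $\mathrm{AC_{00}!}$: every instance of $\mathrm{AC_{00}!}$ is provable in $\mathbf{BIM}+\mathrm{CF_d}$.
   Context: $\mathbf{BIM}$ (Basic Intuitionistic Mathematics, W. Veldman) is a system based on two-sorted intuitionistic predicate logic with number variables and function variables (one-place number-theoretic functions), number equality primitive and $u=v:\equiv\forall x\,u(x)=v(x)$, no $\lambda$-abstraction. Its constants are $0$, a unary function constant for the constant-zero function, one for the identity function, successor $S$, a binary function $J$ (a pairing function onto $\mathbb{N}$) and unary $K,L$ (its projections). Writing $\alpha(m,n)$ for $\alpha(J(m,n))$ (and similarly with more arguments via iterated pairing), its axioms are: equality axioms, the induction schema for all formulas, axioms on the function constants, and closure axioms for the set of functions: closure under composition and pairing ($\forall\alpha\forall\beta\exists\gamma\forall n\,\gamma(n)=J(\alpha(n),\beta(n))$), the axiom of primitive recursion $\forall\alpha\forall\beta\exists\gamma\forall m\forall n[\gamma(m,0)=\alpha(m)\,\&\,\gamma(m,S(n))=\beta(m,n,\gamma(m,n))]$, and the axiom of unbounded search $\forall\alpha[\forall m\exists n\,\alpha(m,n)=0\to\exists\gamma\forall m[\alpha(m,\gamma(m))=0\,\&\,\forall n<\gamma(m)\,\alpha(m,n)\neq0]]$. $\mathrm{AC_{00}!}$: $\forall x\exists! y\,A(x,y)\to\exists\alpha\forall x\,A(x,\alpha(x))$ ($\alpha$ not free in $A$), where $\exists!y\,B(y)\equiv\exists y[B(y)\,\&\,\forall z(B(z)\to y=z)]$. $\mathrm{CF_d}$: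 $\forall x(B(x)\vee\neg B(x))\to\exists\beta\forall x[\beta(x)\le 1\,\&\,(\beta(x)=0\leftrightarrow B(x))]$ ($\beta$ not free in $B$). -}

module Defs where

-- Deep embedding of the formal system BIM (Basic Intuitionistic Mathematics,
-- Veldman) extended by the schema CF_d, and of the schema AC_00!.
-- Variables are de Bruijn indices, with separate index spaces for the two
-- sorts (number variables  v i , function variables  fv i ).

open import Data.Nat using (ℕ; zero; suc)
open import Data.List using (List; []; _∷_; map)
open import Data.List.Membership.Propositional using (_∈_)

data Fn : Set where
  fv    : ℕ → Fn
  zeroF : Fn
  idF   : Fn
  sucF  : Fn
  fstF  : Fn
  sndF  : Fn

infixl 9 _·_
data Tm : Set where
  v    : ℕ → Tm
  `0   : Tm
  pair : Tm → Tm → Tm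
  _·_  : Fn → Tm → Tm

S : Tm → Tm
S t = sucF · t

K : Tm → Tm
K t = fstF · t

L : Tm → Tm
L t = sndF · t

infix  4 _≐_
infixr 3 _∧ᶠ_
infixr 2 _∨ᶠ_
infixr 1 _⇒_
data Fm : Set where
  _≐_  : Tm → Tm → Fm
  ⊥ᶠ   : Fm
  _∧ᶠ_ : Fm → Fm → Fm
  _∨ᶠ_ : Fm → Fm → Fm
  _⇒_  : Fm → Fm → Fm
  ∀ⁿ   : Fm → Fm      -- ∀x  (binds number variable 0)
  ∃ⁿ   : Fm → Fm
  ∀ᶠ   : Fm → Fm      -- ∀α  (binds function variable 0)
  ∃ᶠ   : Fm → Fm

¬ᶠ_ : Fm → Fm
¬ᶠ A = A ⇒ ⊥ᶠ

_⇔_ : Fm → Fm → Fm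
A ⇔ B = (A ⇒ B) ∧ᶠ (B ⇒ A)

renFn : (ℕ → ℕ) → Fn → Fn
renFn σ (fv i) = fv (σ i)
renFn σ g      = g

renT : (ℕ → ℕ) → (ℕ → ℕ) → Tm → Tm
renT ρ σ (v i)      = v (ρ i)
renT ρ σ `0         = `0
renT ρ σ (pair t u) = pair (renT ρ σ t) (renT ρ σ u)
renT ρ σ (g · t)    = renFn σ g · renT ρ σ t

subFn : (ℕ → Fn) → Fn → Fn
subFn f (fv i) = f i
subFn f g      = g

subT : (ℕ → Tm) → (ℕ → Fn) → Tm → Tm
subT s f (v i)      = s i
subT s f `0         = `0
subT s f (pair t u) = pair (subT s f t) (subT s f u)
subT s f (g · t)    = subFn f g · subT s f t

upNs : (ℕ → Tm) → ℕ → Tm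
upNs s zero    = v zero
upNs s (suc i) = renT suc (λ j → j) (s i)

upFs : (ℕ → Tm) → ℕ → Tm
upFs s i = renT (λ j → j) suc (s i)

upFf : (ℕ → Fn) → ℕ → Fn
upFf f zero    = fv zero
upFf f (suc i) = renFn suc (f i)

subF : (ℕ → Tm) → (ℕ → Fn) → Fm → Fm
subF s f (t ≐ u)  = subT s f t ≐ subT s f u
subF s f ⊥ᶠ       = ⊥ᶠ
subF s f (A ∧ᶠ B) = subF s f A ∧ᶠ subF s f B
subF s f (A ∨ᶠ B) = subF s f A ∨ᶠ subF s f B
subF s f (A ⇒ B)  = subF s f A ⇒ subF s f B
subF s f (∀ⁿ A)   = ∀ⁿ (subF (upNs s) f A)
subF s f (∃ⁿ A)   = ∃ⁿ (subF (upNs s) f A)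
subF s f (∀ᶠ A)   = ∀ᶠ (subF (upFs s) (upFf f) A)
subF s f (∃ᶠ A)   = ∃ᶠ (subF (upFs s) (upFf f) A)

wkN : Fm → Fm
wkN = subF (λ i → v (suc i)) fv

wkF : Fm → Fm
wkF = subF v (λ i → fv (suc i))

consT : Tm → (ℕ → Tm) → ℕ → Tm
consT t s zero    = t
consT t s (suc i) = s i

consFn : Fn → (ℕ → Fn) → ℕ → Fn
consFn g f zero    = g
consFn g f (suc i) = f i

-- A[t/x] where x is number variable 0 (the binder is removed)
_[_]ⁿ : Fm → Tm → Fm
A [ t ]ⁿ = subF (consT t v) fv A

-- A[g/α] where α is function variable 0 (the binder is removed)
_[_]ᶠ : Fm → Fn → Fm
A [ g ]ᶠ = subF v (consFn g fv) A

-- Intuitionistic natural deduction over a set of axioms T.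
-- Axioms may contain free variables (read universally, as usual).

data Prf (T : Fm → Set) : List Fm → Fm → Set where
  hyp  : ∀ {Γ A} → A ∈ Γ → Prf T Γ A
  ax   : ∀ {Γ A} → T A → Prf T Γ A
  ⊥E   : ∀ {Γ A} → Prf T Γ ⊥ᶠ → Prf T Γ A
  ∧I   : ∀ {Γ A B} → Prf T Γ A → Prf T Γ B → Prf T Γ (A ∧ᶠ B)
  ∧E₁  : ∀ {Γ A B} → Prf T Γ (A ∧ᶠ B) → Prf T Γ A
  ∧E₂  : ∀ {Γ A B} → Prf T Γ (A ∧ᶠ B) → Prf T Γ B
  ∨I₁  : ∀ {Γ A B} → Prf T Γ A → Prf T Γ (A ∨ᶠ B)
  ∨I₂  : ∀ {Γ A B} → Prf T Γ B → Prf T Γ (A ∨ᶠ B)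
  ∨E   : ∀ {Γ A B C} → Prf T Γ (A ∨ᶠ B) → Prf T (A ∷ Γ) C → Prf T (B ∷ Γ) C
         → Prf T Γ C
  ⇒I   : ∀ {Γ A B} → Prf T (A ∷ Γ) B → Prf T Γ (A ⇒ B)
  ⇒E   : ∀ {Γ A B} → Prf T Γ (A ⇒ B) → Prf T Γ A → Prf T Γ B
  ∀ⁿI  : ∀ {Γ A} → Prf T (map wkN Γ) A → Prf T Γ (∀ⁿ A)
  ∀ⁿE  : ∀ {Γ A} → Prf T Γ (∀ⁿ A) → (t : Tm) → Prf T Γ (A [ t ]ⁿ)
  ∃ⁿI  : ∀ {Γ A} → (t : Tm) → Prf T Γ (A [ t ]ⁿ) → Prf T Γ (∃ⁿ A)
  ∃ⁿE  : ∀ {Γ A C} → Prf T Γ (∃ⁿ A) → Prf T (A ∷ map wkN Γ) (wkN C)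
         → Prf T Γ C
  ∀ᶠI  : ∀ {Γ A} → Prf T (map wkF Γ) A → Prf T Γ (∀ᶠ A)
  ∀ᶠE  : ∀ {Γ A} → Prf T Γ (∀ᶠ A) → (g : Fn) → Prf T Γ (A [ g ]ᶠ)
  ∃ᶠI  : ∀ {Γ A} → (g : Fn) → Prf T Γ (A [ g ]ᶠ) → Prf T Γ (∃ᶠ A)
  ∃ᶠE  : ∀ {Γ A C} → Prf T Γ (∃ᶠ A) → Prf T (A ∷ map wkF Γ) (wkF C)
         → Prf T Γ C

plusRec : Fn → Fm
plusRec g =
  ∀ⁿ (g · pair (v 0) `0 ≐ v 0) ∧ᶠ
  ∀ⁿ (∀ⁿ (g · pair (v 1) (S (v 0)) ≐ S (g · pair (v 1) (v 0))))

-- t < u  :≡  for every addition function β there is k with β(t, S k) = u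
-- (i.e. t + (k+1) = u)
lt : Tm → Tm → Fm
lt t u = ∀ᶠ (plusRec (fv 0) ⇒
           ∃ⁿ (fv 0 · pair (renT suc suc t) (S (v 0)) ≐ renT suc suc u))

le : Tm → Tm → Fm
le t u = lt t (S u)

-- ∃! y B(y)  (B has the bound variable y as number variable 0)
∃!ⁿ : Fm → Fm
∃!ⁿ B = ∃ⁿ (B ∧ᶠ ∀ⁿ (subF s fv B ⇒ v 1 ≐ v 0))
  where
  s : ℕ → Tm
  s zero    = v zero
  s (suc i) = v (suc (suc i))

-- AC_00! instance for A(x,y):  x = number variable 1, y = number variable 0
--   ∀x ∃!y A(x,y) → ∃α ∀x A(x, α(x))      (α fresh)
AC00! : Fm → Fm
AC00! A = ∀ⁿ (∃!ⁿ A) ⇒ ∃ᶠ (∀ⁿ (subF s (λ i → fv (suc i)) A))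
  where
  s : ℕ → Tm
  s zero          = fv 0 · v 0
  s (suc zero)    = v 0
  s (suc (suc i)) = v (suc i)

-- CF_d instance for B(x):  x = number variable 0
--   ∀x (B(x) ∨ ¬B(x)) → ∃β ∀x [β(x) ≤ 1 ∧ (β(x) = 0 ↔ B(x))]   (β fresh)
CFd : Fm → Fm
CFd B = ∀ⁿ (B ∨ᶠ ¬ᶠ B) ⇒
        ∃ᶠ (∀ⁿ (le (fv 0 · v 0) (S `0) ∧ᶠ ((fv 0 · v 0 ≐ `0) ⇔ wkF B)))

data BIM+CFd : Fm → Set where
  eq-refl  : (t : Tm) → BIM+CFd (t ≐ t)
  eq-subst : (A : Fm) (t u : Tm) → BIM+CFd (t ≐ u ⇒ A [ t ]ⁿ ⇒ A [ u ]ⁿ)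
  induction : (A : Fm) →
    BIM+CFd (A [ `0 ]ⁿ ⇒
             ∀ⁿ (A ⇒ subF (consT (S (v 0)) (λ i → v (suc i))) fv A) ⇒
             ∀ⁿ A)
  S-nonzero : BIM+CFd (∀ⁿ (¬ᶠ (S (v 0) ≐ `0)))
  S-inj     : BIM+CFd (∀ⁿ (∀ⁿ (S (v 1) ≐ S (v 0) ⇒ v 1 ≐ v 0)))
  K-J       : BIM+CFd (∀ⁿ (∀ⁿ (K (pair (v 1) (v 0)) ≐ v 1)))
  L-J       : BIM+CFd (∀ⁿ (∀ⁿ (L (pair (v 1) (v 0)) ≐ v 0)))
  J-KL      : BIM+CFd (∀ⁿ (pair (K (v 0)) (L (v 0)) ≐ v 0))
  zero-fun  : BIM+CFd (∀ⁿ (zeroF · v 0 ≐ `0))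
  id-fun    : BIM+CFd (∀ⁿ (idF · v 0 ≐ v 0))
  -- closure under composition:  ∀α∀β∃γ∀n γ(n) = α(β(n))
  composition : BIM+CFd
    (∀ᶠ (∀ᶠ (∃ᶠ (∀ⁿ (fv 0 · v 0 ≐ fv 2 · (fv 1 · v 0))))))
  -- closure under pairing:  ∀α∀β∃γ∀n γ(n) = J(α(n),β(n))
  pairing : BIM+CFd
    (∀ᶠ (∀ᶠ (∃ᶠ (∀ⁿ (fv 0 · v 0 ≐ pair (fv 2 · v 0) (fv 1 · v 0))))))
  -- primitive recursion:
  --   ∀α∀β∃γ∀m∀n[γ(m,0) = α(m) ∧ γ(m,S n) = β(m,n,γ(m,n))]
  prim-rec : BIM+CFd
    (∀ᶠ (∀ᶠ (∃ᶠ (∀ⁿ (∀ⁿ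
      (fv 0 · pair (v 1) `0 ≐ fv 2 · v 1 ∧ᶠ
       fv 0 · pair (v 1) (S (v 0)) ≐
         fv 1 · pair (v 1) (pair (v 0) (fv 0 · pair (v 1) (v 0)))))))))
  -- unbounded search:
  --   ∀α[∀m∃n α(m,n)=0 → ∃γ∀m[α(m,γ(m))=0 ∧ ∀n<γ(m) α(m,n)≠0]]
  unbounded-search : BIM+CFd
    (∀ᶠ (∀ⁿ (∃ⁿ (fv 0 · pair (v 1) (v 0) ≐ `0)) ⇒
         ∃ᶠ (∀ⁿ (fv 1 · pair (v 0) (fv 0 · v 0) ≐ `0 ∧ᶠ
                 ∀ⁿ (lt (v 0) (fv 0 · v 1) ⇒
                     ¬ᶠ (fv 1 · pair (v 1) (v 0) ≐ `0))))))
  cf-d : (B : Fm) → BIM+CFd (CFd B)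

_⊢_ : (Fm → Set) → Fm → Set
T ⊢ A = Prf T [] A

-- Given ∀x∃!y A(x,y), the predicate Graph(p) :≡ A(K p, L p) on codes p = J(x,y) is
-- decidable: with y the unique witness for x = K p, either L p = y and Graph(p), or
-- Graph(p) would force L p = y by uniqueness. CF_d turns Graph into a characteristic
-- function β, which has a zero in every row m (at n = the witness for m), so unbounded
-- search yields γ with β(m, γ m) = 0, i.e. A(m, γ m).

module Submission where

open import Defs
open import Data.Nat using (ℕ; zero; suc; _+_)
open import Data.Product using (_×_; _,_)
open import Data.List using (List; []; _∷_)
open import Data.List.Relation.Unary.Any using (here; there)
open import Function using (_∘_)
open import Relation.Binary.PropositionalEquality

record Subst : Set where
  constructor ⟨_,_⟩
  field
    terms : ℕ → Tm
    funs  : ℕ → Fn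
open Subst

infixl 8 _⟦_⟧
_⟦_⟧ : Fm → Subst → Fm
F ⟦ σ ⟧ = subF (terms σ) (funs σ) F

infixl 9 _⊙_
_⊙_ : Subst → Subst → Subst
σ ⊙ τ = ⟨ subT (terms σ) (funs σ) ∘ terms τ , subFn (funs σ) ∘ funs τ ⟩

infix 4 _≈_
_≈_ : Subst → Subst → Set
σ ≈ τ = terms σ ≗ terms τ × funs σ ≗ funs τ

infixr 5 _∷ˢ_
_∷ˢ_ : Tm → Subst → Subst
t ∷ˢ σ = ⟨ consT t (terms σ) , funs σ ⟩

↑ : ℕ → ℕ → Subst
↑ k l = ⟨ (λ i → v (k + i)) , (λ i → fv (l + i)) ⟩

wkNᵗ : Tm → Tm
wkNᵗ = renT suc (λ j → j)

infixr 5 _∷≗_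
_∷≗_ : ∀ {X : Set} {g h : ℕ → X} → g 0 ≡ h 0 → g ∘ suc ≗ h ∘ suc → g ≗ h
(p ∷≗ ps) zero    = p
(p ∷≗ ps) (suc i) = ps i

renFn-id : ∀ g → renFn (λ j → j) g ≡ g
renFn-id (fv i) = refl
renFn-id zeroF  = refl
renFn-id idF    = refl
renFn-id sucF   = refl
renFn-id fstF   = refl
renFn-id sndF   = refl

subFn-fv : ∀ g → subFn fv g ≡ g
subFn-fv (fv i) = refl
subFn-fv zeroF  = refl
subFn-fv idF    = refl
subFn-fv sucF   = refl
subFn-fv fstF   = refl
subFn-fv sndF   = refl

subFn-cong : ∀ {f f'} → f ≗ f' → subFn f ≗ subFn f'
subFn-cong f≗f' (fv i) = f≗f' i
subFn-cong f≗f' zeroF  = refl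
subFn-cong f≗f' idF    = refl
subFn-cong f≗f' sucF   = refl
subFn-cong f≗f' fstF   = refl
subFn-cong f≗f' sndF   = refl

subT-cong : ∀ {s s' f f'} → s ≗ s' → f ≗ f' → subT s f ≗ subT s' f'
subT-cong s≗s' f≗f' (v i)      = s≗s' i
subT-cong s≗s' f≗f' `0         = refl
subT-cong s≗s' f≗f' (pair t u) = cong₂ pair (subT-cong s≗s' f≗f' t) (subT-cong s≗s' f≗f' u)
subT-cong s≗s' f≗f' (g · t)    = cong₂ _·_ (subFn-cong f≗f' g) (subT-cong s≗s' f≗f' t)

upNs-cong : ∀ {s s'} → s ≗ s' → upNs s ≗ upNs s'
upNs-cong s≗s' zero    = refl
upNs-cong s≗s' (suc i) = cong wkNᵗ (s≗s' i)

upFs-cong : ∀ {s s'} → s ≗ s' → upFs s ≗ upFs s'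
upFs-cong s≗s' i = cong (renT (λ j → j) suc) (s≗s' i)

upFf-cong : ∀ {f f'} → f ≗ f' → upFf f ≗ upFf f'
upFf-cong f≗f' zero    = refl
upFf-cong f≗f' (suc i) = cong (renFn suc) (f≗f' i)

subF-cong : ∀ {s s' f f'} → s ≗ s' → f ≗ f' → subF s f ≗ subF s' f'
subF-cong s≗s' f≗f' (t ≐ u)  = cong₂ _≐_ (subT-cong s≗s' f≗f' t) (subT-cong s≗s' f≗f' u)
subF-cong s≗s' f≗f' ⊥ᶠ       = refl
subF-cong s≗s' f≗f' (A ∧ᶠ B) = cong₂ _∧ᶠ_ (subF-cong s≗s' f≗f' A) (subF-cong s≗s' f≗f' B)
subF-cong s≗s' f≗f' (A ∨ᶠ B) = cong₂ _∨ᶠ_ (subF-cong s≗s' f≗f' A) (subF-cong s≗s' f≗f' B)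
subF-cong s≗s' f≗f' (A ⇒ B)  = cong₂ _⇒_ (subF-cong s≗s' f≗f' A) (subF-cong s≗s' f≗f' B)
subF-cong s≗s' f≗f' (∀ⁿ A)   = cong ∀ⁿ (subF-cong (upNs-cong s≗s') f≗f' A)
subF-cong s≗s' f≗f' (∃ⁿ A)   = cong ∃ⁿ (subF-cong (upNs-cong s≗s') f≗f' A)
subF-cong s≗s' f≗f' (∀ᶠ A)   = cong ∀ᶠ (subF-cong (upFs-cong s≗s') (upFf-cong f≗f') A)
subF-cong s≗s' f≗f' (∃ᶠ A)   = cong ∃ᶠ (subF-cong (upFs-cong s≗s') (upFf-cong f≗f') A)

subFn-∘ : ∀ f f' → subFn f ∘ subFn f' ≗ subFn (subFn f ∘ f')
subFn-∘ f f' (fv i) = refl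
subFn-∘ f f' zeroF  = refl
subFn-∘ f f' idF    = refl
subFn-∘ f f' sucF   = refl
subFn-∘ f f' fstF   = refl
subFn-∘ f f' sndF   = refl

subT-∘ : ∀ s f s' f' → subT s f ∘ subT s' f' ≗ subT (subT s f ∘ s') (subFn f ∘ f')
subT-∘ s f s' f' (v i)      = refl
subT-∘ s f s' f' `0         = refl
subT-∘ s f s' f' (pair t u) = cong₂ pair (subT-∘ s f s' f' t) (subT-∘ s f s' f' u)
subT-∘ s f s' f' (g · t)    = cong₂ _·_ (subFn-∘ f f' g) (subT-∘ s f s' f' t)

subT-upNs-wkNᵗ : ∀ s f t → subT (upNs s) f (wkNᵗ t) ≡ wkNᵗ (subT s f t)
subT-upNs-wkNᵗ s f (v i)      = refl
subT-upNs-wkNᵗ s f `0         = refl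
subT-upNs-wkNᵗ s f (pair t u) = cong₂ pair (subT-upNs-wkNᵗ s f t) (subT-upNs-wkNᵗ s f u)
subT-upNs-wkNᵗ s f (g · t)    =
  cong₂ _·_ (trans (cong (subFn f) (renFn-id g)) (sym (renFn-id (subFn f g)))) (subT-upNs-wkNᵗ s f t)

subFn-upFf-renFn : ∀ f g → subFn (upFf f) (renFn suc g) ≡ renFn suc (subFn f g)
subFn-upFf-renFn f (fv i) = refl
subFn-upFf-renFn f zeroF  = refl
subFn-upFf-renFn f idF    = refl
subFn-upFf-renFn f sucF   = refl
subFn-upFf-renFn f fstF   = refl
subFn-upFf-renFn f sndF   = refl

subT-upFs-renT : ∀ s f t →
  subT (upFs s) (upFf f) (renT (λ j → j) suc t) ≡ renT (λ j → j) suc (subT s f t)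
subT-upFs-renT s f (v i)      = refl
subT-upFs-renT s f `0         = refl
subT-upFs-renT s f (pair t u) = cong₂ pair (subT-upFs-renT s f t) (subT-upFs-renT s f u)
subT-upFs-renT s f (g · t)    = cong₂ _·_ (subFn-upFf-renFn f g) (subT-upFs-renT s f t)

upNs-∘ : ∀ s f s' → subT (upNs s) f ∘ upNs s' ≗ upNs (subT s f ∘ s')
upNs-∘ s f s' zero    = refl
upNs-∘ s f s' (suc i) = subT-upNs-wkNᵗ s f (s' i)

upFf-∘ : ∀ f f' → subFn (upFf f) ∘ upFf f' ≗ upFf (subFn f ∘ f')
upFf-∘ f f' zero    = refl
upFf-∘ f f' (suc i) = subFn-upFf-renFn f (f' i)

subF-upNs-∘ : ∀ s f s' f' A →
  subF (upNs s) f (subF (upNs s') f' A) ≡ subF (upNs (subT s f ∘ s')) (subFn f ∘ f') A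
subF-upFs-∘ : ∀ s f s' f' A →
  subF (upFs s) (upFf f) (subF (upFs s') (upFf f') A) ≡
  subF (upFs (subT s f ∘ s')) (upFf (subFn f ∘ f')) A

subF-∘ : ∀ s f s' f' → subF s f ∘ subF s' f' ≗ subF (subT s f ∘ s') (subFn f ∘ f')
subF-∘ s f s' f' (t ≐ u)  = cong₂ _≐_ (subT-∘ s f s' f' t) (subT-∘ s f s' f' u)
subF-∘ s f s' f' ⊥ᶠ       = refl
subF-∘ s f s' f' (A ∧ᶠ B) = cong₂ _∧ᶠ_ (subF-∘ s f s' f' A) (subF-∘ s f s' f' B)
subF-∘ s f s' f' (A ∨ᶠ B) = cong₂ _∨ᶠ_ (subF-∘ s f s' f' A) (subF-∘ s f s' f' B)
subF-∘ s f s' f' (A ⇒ B)  = cong₂ _⇒_ (subF-∘ s f s' f' A) (subF-∘ s f s' f' B)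
subF-∘ s f s' f' (∀ⁿ A)   = cong ∀ⁿ (subF-upNs-∘ s f s' f' A)
subF-∘ s f s' f' (∃ⁿ A)   = cong ∃ⁿ (subF-upNs-∘ s f s' f' A)
subF-∘ s f s' f' (∀ᶠ A)   = cong ∀ᶠ (subF-upFs-∘ s f s' f' A)
subF-∘ s f s' f' (∃ᶠ A)   = cong ∃ᶠ (subF-upFs-∘ s f s' f' A)

subF-upNs-∘ s f s' f' A =
  trans (subF-∘ (upNs s) f (upNs s') f' A) (subF-cong (upNs-∘ s f s') (λ _ → refl) A)

subF-upFs-∘ s f s' f' A =
  trans (subF-∘ (upFs s) (upFf f) (upFs s') (upFf f') A)
        (subF-cong (λ i → subT-upFs-renT s f (s' i)) (upFf-∘ f f') A)

⟦⟧-cong : ∀ {σ τ} → σ ≈ τ → ∀ F → F ⟦ σ ⟧ ≡ F ⟦ τ ⟧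
⟦⟧-cong (s≗s' , f≗f') = subF-cong s≗s' f≗f'

⟦⟧-⊙ : ∀ {F σ τ} → F ⟦ τ ⟧ ⟦ σ ⟧ ≡ F ⟦ σ ⊙ τ ⟧
⟦⟧-⊙ {F} {σ} {τ} = subF-∘ (terms σ) (funs σ) (terms τ) (funs τ) F

⟦⟧-⊙³ : ∀ {F σ τ ρ} → F ⟦ ρ ⟧ ⟦ τ ⟧ ⟦ σ ⟧ ≡ F ⟦ σ ⊙ τ ⊙ ρ ⟧
⟦⟧-⊙³ = trans ⟦⟧-⊙ ⟦⟧-⊙

⟦⟧-⊙⁴ : ∀ {F σ τ ρ π} → F ⟦ π ⟧ ⟦ ρ ⟧ ⟦ τ ⟧ ⟦ σ ⟧ ≡ F ⟦ σ ⊙ τ ⊙ ρ ⊙ π ⟧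
⟦⟧-⊙⁴ = trans ⟦⟧-⊙ ⟦⟧-⊙³

⟦⟧-⊙⁵ : ∀ {F σ τ ρ π μ} → F ⟦ μ ⟧ ⟦ π ⟧ ⟦ ρ ⟧ ⟦ τ ⟧ ⟦ σ ⟧ ≡ F ⟦ σ ⊙ τ ⊙ ρ ⊙ π ⊙ μ ⟧
⟦⟧-⊙⁵ = trans ⟦⟧-⊙ ⟦⟧-⊙⁴

subT-cons-wkNᵗ : ∀ t u → subT (consT t v) fv (wkNᵗ u) ≡ u
subT-cons-wkNᵗ t (v i)      = refl
subT-cons-wkNᵗ t `0         = refl
subT-cons-wkNᵗ t (pair u w) = cong₂ pair (subT-cons-wkNᵗ t u) (subT-cons-wkNᵗ t w)
subT-cons-wkNᵗ t (g · u)    = cong₂ _·_ (trans (subFn-fv _) (renFn-id g)) (subT-cons-wkNᵗ t u)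

infix 0 _⊩_
_⊩_ : List Fm → Fm → Set
Γ ⊩ A = Prf BIM+CFd Γ A

-- The formulas met in the derivations below are iterated substitution instances of a
-- single formula F; two of them are identified by fusing each into one substitution
-- (⟦⟧-⊙ⁿ) and comparing the two pointwise.
convert : ∀ {Γ X Y F σ τ} → X ≡ F ⟦ σ ⟧ → Y ≡ F ⟦ τ ⟧ → σ ≈ τ → Γ ⊩ X → Γ ⊩ Y
convert {Γ} {F = F} X≡ Y≡ σ≈τ = subst (Γ ⊩_) (trans X≡ (trans (⟦⟧-cong σ≈τ F) (sym Y≡)))

≐-subst : ∀ {Γ t u} (Φ : Tm → Fm) G → (∀ w → G [ w ]ⁿ ≡ Φ w) →
          Γ ⊩ t ≐ u → Γ ⊩ Φ t → Γ ⊩ Φ u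
≐-subst {Γ} {t} {u} Φ G G[w]≡Φw t≐u Φt =
  subst (Γ ⊩_) (G[w]≡Φw u)
    (⇒E (⇒E (ax (eq-subst G t u)) t≐u) (subst (Γ ⊩_) (sym (G[w]≡Φw t)) Φt))

≐-refl : ∀ {Γ} t → Γ ⊩ t ≐ t
≐-refl t = ax (eq-refl t)

≐-sym : ∀ {Γ t u} → Γ ⊩ t ≐ u → Γ ⊩ u ≐ t
≐-sym {t = t} t≐u =
  ≐-subst (_≐ t) (v 0 ≐ wkNᵗ t) (λ w → cong (w ≐_) (subT-cons-wkNᵗ w t)) t≐u (≐-refl t)

≐-subst₂ : ∀ {Γ t t' u u'} F σ → Γ ⊩ t ≐ t' → Γ ⊩ u ≐ u' →
           Γ ⊩ F ⟦ t ∷ˢ u ∷ˢ σ ⟧ → Γ ⊩ F ⟦ t' ∷ˢ u' ∷ˢ σ ⟧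
≐-subst₂ {Γ} {t} {t'} {u} {u'} F σ t≐t' u≐u' = second ∘ first
  where
  wkNσ : Subst
  wkNσ = ⟨ wkNᵗ ∘ terms σ , funs σ ⟩

  terms-inst : ∀ w → subT (consT w v) fv ∘ terms wkNσ ≗ terms σ
  terms-inst w i = subT-cons-wkNᵗ w (terms σ i)

  funs-inst : subFn fv ∘ funs σ ≗ funs σ
  funs-inst i = subFn-fv (funs σ i)

  first : Γ ⊩ F ⟦ t ∷ˢ u ∷ˢ σ ⟧ → Γ ⊩ F ⟦ t' ∷ˢ u ∷ˢ σ ⟧
  first = ≐-subst (λ w → F ⟦ w ∷ˢ u ∷ˢ σ ⟧) (F ⟦ v 0 ∷ˢ wkNᵗ u ∷ˢ wkNσ ⟧)
    (λ w → trans ⟦⟧-⊙ (⟦⟧-cong ((refl ∷≗ subT-cons-wkNᵗ w u ∷≗ terms-inst w) , funs-inst) F))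
    t≐t'

  second : Γ ⊩ F ⟦ t' ∷ˢ u ∷ˢ σ ⟧ → Γ ⊩ F ⟦ t' ∷ˢ u' ∷ˢ σ ⟧
  second = ≐-subst (λ w → F ⟦ t' ∷ˢ w ∷ˢ σ ⟧) (F ⟦ wkNᵗ t' ∷ˢ v 0 ∷ˢ wkNσ ⟧)
    (λ w → trans ⟦⟧-⊙ (⟦⟧-cong ((subT-cons-wkNᵗ w t' ∷≗ refl ∷≗ terms-inst w) , funs-inst) F))
    u≐u'

K-pair : ∀ {Γ} t u → Γ ⊩ K (pair t u) ≐ t
K-pair t u = subst (λ w → _ ⊩ K (pair w u) ≐ w) (subT-cons-wkNᵗ u t) (∀ⁿE (∀ⁿE (ax K-J) t) u)

L-pair : ∀ {Γ} t u → Γ ⊩ L (pair t u) ≐ u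
L-pair t u = subst (λ w → _ ⊩ L (pair w u) ≐ u) (subT-cons-wkNᵗ u t) (∀ⁿE (∀ⁿE (ax L-J) t) u)

unpair : ∀ {Γ} F σ t u → Γ ⊩ F ⟦ L (pair t u) ∷ˢ K (pair t u) ∷ˢ σ ⟧ → Γ ⊩ F ⟦ u ∷ˢ t ∷ˢ σ ⟧
unpair F σ t u = ≐-subst₂ F σ (L-pair t u) (K-pair t u)

repair : ∀ {Γ} F σ t u → Γ ⊩ F ⟦ u ∷ˢ t ∷ˢ σ ⟧ → Γ ⊩ F ⟦ L (pair t u) ∷ˢ K (pair t u) ∷ˢ σ ⟧
repair F σ t u = ≐-subst₂ F σ (≐-sym (L-pair t u)) (≐-sym (K-pair t u))

S-cong : ∀ {Γ t u} → Γ ⊩ t ≐ u → Γ ⊩ S t ≐ S u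
S-cong {t = t} t≐u =
  ≐-subst (λ w → S t ≐ S w) (S (wkNᵗ t) ≐ S (v 0))
    (λ w → cong (λ t' → S t' ≐ S w) (subT-cons-wkNᵗ w t)) t≐u (≐-refl (S t))

S-injective : ∀ {Γ t u} → Γ ⊩ S t ≐ S u → Γ ⊩ t ≐ u
S-injective {t = t} {u} =
  ⇒E (subst (λ w → _ ⊩ S w ≐ S u ⇒ w ≐ u) (subT-cons-wkNᵗ u t) (∀ⁿE (∀ⁿE (ax S-inj) t) u))

S≢0 : ∀ {Γ} t → Γ ⊩ ¬ᶠ (S t ≐ `0)
S≢0 t = ∀ⁿE (ax S-nonzero) t

infix 4 _≐?_
_≐?_ : Tm → Tm → Fm
t ≐? u = t ≐ u ∨ᶠ ¬ᶠ (t ≐ u)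

≐-dec : ∀ {Γ} → Γ ⊩ ∀ⁿ (∀ⁿ (v 1 ≐? v 0))
≐-dec = ⇒E (⇒E (ax (induction (∀ⁿ (v 1 ≐? v 0)))) zero-≐?) suc-≐?
  where
  zero-≐? : ∀ {Γ} → Γ ⊩ ∀ⁿ (`0 ≐? v 0)
  zero-≐? = ⇒E (⇒E (ax (induction (`0 ≐? v 0))) (∨I₁ (≐-refl `0)))
               (∀ⁿI (⇒I (∨I₂ (⇒I (⇒E (S≢0 (v 0)) (≐-sym (hyp (here refl))))))))

  suc-≐? : ∀ {Γ} → Γ ⊩ ∀ⁿ (∀ⁿ (v 1 ≐? v 0) ⇒ ∀ⁿ (S (v 1) ≐? v 0))
  suc-≐? = ∀ⁿI (⇒I (⇒E (⇒E (ax (induction (S (v 1) ≐? v 0))) (∨I₂ (S≢0 (v 0))))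
             (∀ⁿI (⇒I (∨E (∀ⁿE (hyp (there (here refl))) (v 0))
               (∨I₁ (S-cong (hyp (here refl))))
               (∨I₂ (⇒I (⇒E (hyp (there (here refl))) (S-injective (hyp (here refl)))))))))))


module Choice (A : Fm) where

  Functional : Fm
  Functional = ∀ⁿ (∃!ⁿ A)

  Graph : Fm
  Graph = A ⟦ L (v 0) ∷ˢ K (v 0) ∷ˢ ↑ 1 0 ⟧

  -- the conclusion of CF_d for Graph, about the function variable fv 0
  Characteristic : Fm
  Characteristic = ∀ⁿ (le (fv 0 · v 0) (S `0) ∧ᶠ ((fv 0 · v 0 ≐ `0) ⇔ wkF Graph))

  -- the conclusion of unbounded search for α := fv 1, about γ := fv 0
  LeastZeroSelector : Fm
  LeastZeroSelector =
    ∀ⁿ (fv 1 · pair (v 0) (fv 0 · v 0) ≐ `0 ∧ᶠ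
        ∀ⁿ (lt (v 0) (fv 0 · v 1) ⇒ ¬ᶠ (fv 1 · pair (v 1) (v 0) ≐ `0)))

  Graph-decidable : ∀ {Γ} → Functional ∷ Γ ⊩ ∀ⁿ (Graph ∨ᶠ ¬ᶠ Graph)
  Graph-decidable = ∀ⁿI (∃ⁿE (∀ⁿE (hyp (here refl)) (K (v 0)))
    (∨E (∀ⁿE (∀ⁿE ≐-dec (v 0)) (L (v 1)))
      (∨I₁ (convert refl ⟦⟧-⊙ ((refl ∷≗ refl ∷≗ λ _ → refl) , λ _ → refl)
        (≐-subst₂ A (↑ 2 0) (hyp (here refl)) (≐-refl (K (v 1)))
          (convert ⟦⟧-⊙ refl ((refl ∷≗ refl ∷≗ λ _ → refl) , λ _ → refl)
            (∧E₁ (hyp (there (here refl))))))))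
      (∨I₂ (⇒I (⇒E (hyp (there (here refl)))
        (⇒E (∀ⁿE (∧E₂ (hyp (there (there (here refl))))) (L (v 1)))
          (convert ⟦⟧-⊙ ⟦⟧-⊙⁴ ((refl ∷≗ refl ∷≗ λ _ → refl) , λ _ → refl)
            (hyp (here refl)))))))))

  characteristic-has-zeros : ∀ {Γ} →
    Characteristic ∷ wkF Functional ∷ Γ ⊩ ∀ⁿ (∃ⁿ (fv 0 · pair (v 1) (v 0) ≐ `0))
  characteristic-has-zeros = ∀ⁿI (∃ⁿE (∀ⁿE (hyp (there (here refl))) (v 0)) (∃ⁿI (v 0)
    (⇒E (∧E₂ (∧E₂ (∀ⁿE (hyp (there (here refl))) (pair (v 1) (v 0)))))
      (convert refl ⟦⟧-⊙⁵ ((refl ∷≗ refl ∷≗ λ _ → refl) , λ _ → refl)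
        (repair A (↑ 2 1) (v 1) (v 0)
          (convert ⟦⟧-⊙³ refl ((refl ∷≗ refl ∷≗ λ _ → refl) , λ _ → refl)
            (∧E₁ (hyp (here refl)))))))))

  selector-chooses : ∀ {Γ} →
    wkN LeastZeroSelector ∷ wkN (wkF Characteristic) ∷ Γ ⊩ A ⟦ fv 0 · v 0 ∷ˢ v 0 ∷ˢ ↑ 1 2 ⟧
  selector-chooses = unpair A (↑ 1 2) (v 0) (fv 0 · v 0)
    (convert ⟦⟧-⊙⁵ refl ((refl ∷≗ refl ∷≗ λ _ → refl) , λ _ → refl)
      (⇒E (∧E₁ (∧E₂ (∀ⁿE (hyp (there (here refl))) (pair (v 0) (fv 0 · v 0)))))
        (∧E₁ (∀ⁿE (hyp (here refl)) (v 0)))))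

proposition7p1 : (A : Fm) → BIM+CFd ⊢ AC00! A
proposition7p1 A =
  ⇒I (∃ᶠE (⇒E (ax (cf-d Graph)) Graph-decidable)
     (∃ᶠE (⇒E (∀ᶠE (ax unbounded-search) (fv 0)) characteristic-has-zeros)
     (∃ᶠI (fv 0) (∀ⁿI
       (convert refl ⟦⟧-⊙⁴ ((refl ∷≗ refl ∷≗ λ _ → refl) , λ _ → refl) selector-chooses)))))
  where open Choice A
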